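{- Let $p \geq 3$ be an integer. Then $\zeta(C_{2p} \square C_6) = 2$.
   Context: The localization game on a connected graph $G$ is played by a Cop controlling $k$ cops and a Robber. The Robber first chooses a vertex $r$, unknown to the Cop. In each turn the Cop probes a set $B=\{b_1,\dots,b_k\}$ of $k$ vertices and receives the distance vector $[d_G(r,b_1),\dots,d_G(r,b_k)]$. If the Cop can determine $r$ exactly, the Cop wins; otherwise the Robber may stay at $r$ or move to a neighbour of $r$, and the next turn begins. The Cop wins if the Robber is located after finitely many turns. The localization number $\zeta(G)$ is the least positive integer $k$ such that the Cop has a winning strategy with $k$ cops. $C_n$ is the cycle of order $n$ and $\square$ the Cartesian product. -}

module Defs where

open import Data.Bool using (Bool; true; false; _∨_; _∧_; if_then_else_)
open import Data.Nat using (ℕ; zero; suc; _≡ᵇ_; _*_)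
open import Data.Fin using (Fin; toℕ)
import Data.Fin as Fin
open import Data.Bool.ListAction using (any)
open import Data.List using (List; []; _∷_; length; allFin; cartesianProduct)
open import Data.Vec using (Vec; map)
open import Data.Product using (Σ; _×_; _,_; ∃)
open import Data.Product.Properties using (≡-dec)
open import Data.Sum using (_⊎_)
open import Relation.Nullary using (¬_; does)
open import Relation.Binary.Definitions using (DecidableEquality)
open import Relation.Binary.PropositionalEquality using (_≡_)

record Graph : Set₁ where
  field
    V      : Set
    verts  : List V
    _≟V_   : DecidableEquality V
    adj    : V → V → Bool

open Graph public

cycleAdj : (m : ℕ) → Fin m → Fin m → Bool
cycleAdj m i j =
  (toℕ j ≡ᵇ suc (toℕ i)) ∨ (toℕ i ≡ᵇ suc (toℕ j))
  ∨ ((toℕ i ≡ᵇ 0) ∧ (suc (toℕ j) ≡ᵇ m))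
  ∨ ((toℕ j ≡ᵇ 0) ∧ (suc (toℕ i) ≡ᵇ m))

Cycle : ℕ → Graph
Cycle m = record { V = Fin m ; verts = allFin m ; _≟V_ = Fin._≟_ ; adj = cycleAdj m }

_□_ : Graph → Graph → Graph
G □ H = record
  { V = V G × V H
  ; verts = cartesianProduct (verts G) (verts H)
  ; _≟V_ = ≡-dec (_≟V_ G) (_≟V_ H)
  ; adj = λ { (a , b) (a' , b') →
        (adj G a a' ∧ does (_≟V_ H b b')) ∨ (does (_≟V_ G a a') ∧ adj H b b') }
  }

within : (G : Graph) → ℕ → V G → V G → Bool
within G zero    u v = does (_≟V_ G u v)
within G (suc m) u v = within G m u v ∨ any (λ x → adj G u x ∧ within G m x v) (verts G)

-- least m < N with f m = true (N if there is none)
leastTrue : (ℕ → Bool) → ℕ → ℕ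
leastTrue f zero    = zero
leastTrue f (suc N) = if f zero then zero else suc (leastTrue (λ m → f (suc m)) N)

-- Graph distance d_G(u,v): length of a shortest u–v walk (for connected G
-- it is always < number of vertices).
dist : (G : Graph) → V G → V G → ℕ
dist G u v = leastTrue (λ m → within G m u v) (length (verts G))

IsWalk : (G : Graph) → (ℕ → V G) → Set
IsWalk G w = ∀ i → (w (suc i) ≡ w i) ⊎ (adj G (w i) (w (suc i)) ≡ true)

-- A Cop strategy with k cops: given the history of distance vectors received
-- so far (most recent first), choose the k probed vertices.
Strategy : Graph → ℕ → Set
Strategy G k = List (Vec ℕ k) → Vec (V G) k

-- history σ w t : the distance vectors received in turns 0,…,t-1.
history : (G : Graph) {k : ℕ} → Strategy G k → (ℕ → V G) → ℕ → List (Vec ℕ k)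
history G σ w zero    = []
history G σ w (suc t) =
  map (dist G (w t)) (σ (history G σ w t)) ∷ history G σ w t

-- After the probe of turn t the Cop can determine the Robber's position:
-- every Robber trajectory consistent with all answers so far is at w t.
LocatedAt : (G : Graph) {k : ℕ} → Strategy G k → (ℕ → V G) → ℕ → Set
LocatedAt G σ w t =
  ∀ w' → IsWalk G w' → history G σ w' (suc t) ≡ history G σ w (suc t) → w' t ≡ w t

CopWins : Graph → ℕ → Set
CopWins G k = Σ (Strategy G k) λ σ → ∀ w → IsWalk G w → ∃ λ t → LocatedAt G σ w t

LocalizationNumberIs : Graph → ℕ → Set
LocalizationNumberIs G k =
  CopWins G k × (∀ j → 1 Data.Nat.≤ j → j Data.Nat.< k → ¬ CopWins G j)

-- One cop loses on G □ C₆ for every connected G: the Robber keeps to one column and, knowing the row y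
-- that will be probed, moves to a row r with d(r, y) = d(r + 2, y).  The walk two rows higher is then
-- legal as well and produces exactly the same answers forever.
--
-- Two cops win on C₂ₚ □ C₆ after three probes.  Probing (0, 0) and (1, 0) tells on which side of
-- column 0 the Robber is and its column up to the height d(j, 0) ≤ 3 of its row j, so it lies on a
-- known diagonal of six vertices in a window of eight consecutive columns.  As p ≥ 3, distances between
-- vertices of the window whose columns differ by at most 3 do not wrap around the cycle; the rest of the
-- game is therefore a finite game on the window, settled by evaluating all six starting rows and all
-- Robber moves.

module Submission where

open import Defs
open import Data.Bool using (Bool; true; false; _∨_; _∧_; if_then_else_)
import Data.Bool.Properties as Bool
open import Data.Bool.ListAction using (any)
open import Data.Empty using (⊥-elim)
open import Data.Fin using (Fin; toℕ; fromℕ<; #_)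
import Data.Fin as Fin
import Data.Fin.Properties as Fin
open import Data.Fin.Properties using (toℕ<n; toℕ-fromℕ<; toℕ-injective)
open import Data.List using (List; []; _∷_; length; cartesianProduct; allFin; concatMap; findᵇ)
import Data.List as List
open import Data.List.Properties using (length-++; length-map; length-tabulate)
open import Data.List.Membership.Propositional using (_∈_; find; lose)
open import Data.List.Membership.Propositional.Properties using (∈-cartesianProduct⁺; ∈-allFin)
open import Data.List.Relation.Unary.Any.Properties using (any⁺; any⁻)
open import Data.Maybe using (fromMaybe)
import Data.Maybe as Maybe
open import Data.Nat
open import Data.Nat.Properties
open import Data.Nat.DivMod
open import Data.Nat.Solver using (module +-*-Solver)
open +-*-Solver using (solve; _:+_; _:=_; con)
open import Data.Product using (_×_; _,_; ∃; proj₁; proj₂)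
open import Data.Product.Properties using (≡-dec)
open import Data.Sum using (_⊎_; inj₁; inj₂)
open import Data.Vec using (Vec; []; _∷_; head; map)
import Data.Vec.Properties as Vec
open import Function using (_∘_)
open import Function.Bundles using (Equivalence)
open import Relation.Binary.Definitions using (tri<; tri≈; tri>)
open import Relation.Binary.PropositionalEquality
open import Relation.Nullary using (¬_; ¬?; Dec; does; yes; no)
open import Relation.Nullary.Decidable using (True; toWitness; dec-true; dec-false; _×-dec_; _⊎-dec_; _→-dec_)

∨-true⁻ : ∀ a {b} → a ∨ b ≡ true → a ≡ true ⊎ b ≡ true
∨-true⁻ true  _ = inj₁ refl
∨-true⁻ false e = inj₂ e

∨-trueʳ : ∀ a {b} → b ≡ true → a ∨ b ≡ true
∨-trueʳ a refl = Bool.∨-zeroʳ a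

∧-true⁻ : ∀ a {b} → a ∧ b ≡ true → a ≡ true × b ≡ true
∧-true⁻ true e = refl , e

∧-true⁺ : ∀ {a b} → a ≡ true → b ≡ true → a ∧ b ≡ true
∧-true⁺ refl refl = refl

any-true⁻ : ∀ {A : Set} (f : A → Bool) xs → any f xs ≡ true → ∃ λ x → x ∈ xs × f x ≡ true
any-true⁻ f xs e with find (any⁻ f xs (Equivalence.from Bool.T-≡ e))
... | x , x∈xs , fx = x , x∈xs , Equivalence.to Bool.T-≡ fx

any-true⁺ : ∀ {A : Set} (f : A → Bool) {xs x} → x ∈ xs → f x ≡ true → any f xs ≡ true
any-true⁺ f x∈xs fx = Equivalence.to Bool.T-≡ (any⁺ f (lose x∈xs (Equivalence.from Bool.T-≡ fx)))

does-true⁻ : ∀ {A : Set} {a b : A} (d : Dec (a ≡ b)) → does d ≡ true → a ≡ b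
does-true⁻ (yes a≡b) _ = a≡b

≡ᵇ-true⁻ : ∀ m n → (m ≡ᵇ n) ≡ true → m ≡ n
≡ᵇ-true⁻ m n e = ≡ᵇ⇒≡ m n (Equivalence.from Bool.T-≡ e)

≡ᵇ-refl : ∀ m → (m ≡ᵇ m) ≡ true
≡ᵇ-refl m = Equivalence.to Bool.T-≡ (≡⇒≡ᵇ m m refl)

-- Finite checks by evaluation: the implicit argument is solved only if P? computes to yes everywhere.
decide₁ : ∀ {m} {P : Fin m → Set} (P? : ∀ a → Dec (P a)) → {True (Fin.all? P?)} → ∀ a → P a
decide₁ P? {ok} = toWitness ok

decide₂ : ∀ {m k} {P : Fin m → Fin k → Set} (P? : ∀ a b → Dec (P a b)) →
          {True (Fin.all? λ a → Fin.all? (P? a))} → ∀ a b → P a b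
decide₂ P? {ok} = toWitness ok

decide₃ : ∀ {l m k} {P : Fin l → Fin m → Fin k → Set} (P? : ∀ a b c → Dec (P a b c)) →
          {True (Fin.all? λ a → Fin.all? λ b → Fin.all? (P? a b))} → ∀ a b c → P a b c
decide₃ P? {ok} = toWitness ok

-- Distances in finite graphs

leastTrue-≡ : ∀ (f : ℕ → Bool) {N k} → k < N → f k ≡ true → (∀ {i} → i < k → f i ≡ false) →
              leastTrue f N ≡ k
leastTrue-≡ f {suc N} {zero}  _         fk _     rewrite fk = refl
leastTrue-≡ f {suc N} {suc k} (s≤s k<N) fk below rewrite below {0} (s≤s z≤n) =
  cong suc (leastTrue-≡ (f ∘ suc) k<N fk (below ∘ s≤s))

record DistanceFunction (G : Graph) : Set where
  field
    ∈-verts   : ∀ v → v ∈ verts G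
    δ         : V G → V G → ℕ
    δ-refl    : ∀ u → δ u u ≡ 0
    δ≡0⇒≡     : ∀ {u v} → δ u v ≡ 0 → u ≡ v
    δ-adj     : ∀ {u x} v → adj G u x ≡ true → δ u v ≤ suc (δ x v)
    δ-descent : ∀ {u v k} → δ u v ≡ suc k → ∃ λ x → adj G u x ≡ true × δ x v < δ u v
    δ<∣V∣     : ∀ u v → δ u v < length (verts G)

module _ {G : Graph} (D : DistanceFunction G) where
  open DistanceFunction D

  within⇒δ≤ : ∀ m {u v} → within G m u v ≡ true → δ u v ≤ m
  within⇒δ≤ zero {u} {v} e with _≟V_ G u v
  ... | yes refl = ≤-reflexive (δ-refl u)
  within⇒δ≤ (suc m) {u} {v} e with ∨-true⁻ (within G m u v) e
  ... | inj₁ short = m≤n⇒m≤1+n (within⇒δ≤ m short)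
  ... | inj₂ viaNeighbour with any-true⁻ _ (verts G) viaNeighbour
  ...   | x , _ , ux∧xv with ∧-true⁻ (adj G u x) ux∧xv
  ...     | u~x , xv = ≤-trans (δ-adj v u~x) (s≤s (within⇒δ≤ m xv))

  δ≤⇒within : ∀ m {u v} → δ u v ≤ m → within G m u v ≡ true
  δ≤⇒within zero {u} {v} δ≤0 rewrite δ≡0⇒≡ (n≤0⇒n≡0 δ≤0) = dec-true (_≟V_ G v v) refl
  δ≤⇒within (suc m) {u} {v} δ≤ with δ u v ≤? m
  ... | yes δ≤m rewrite δ≤⇒within m δ≤m = refl
  ... | no  δ≰m with δ-descent (≤-antisym δ≤ (≰⇒> δ≰m))
  ...   | x , u~x , δx< =
    ∨-trueʳ (within G m u v) (any-true⁺ _ (∈-verts x) (∧-true⁺ u~x (δ≤⇒within m δx≤m)))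
    where
      δx≤m : δ x v ≤ m
      δx≤m = ≤-pred (≤-trans δx< δ≤)

  dist≡δ : ∀ u v → dist G u v ≡ δ u v
  dist≡δ u v = leastTrue-≡ _ (δ<∣V∣ u v) (δ≤⇒within _ ≤-refl) below
    where
      below : ∀ {i} → i < δ u v → within G i u v ≡ false
      below {i} i<δ with within G i u v in e
      ... | true  = ⊥-elim (<⇒≱ i<δ (within⇒δ≤ i e))
      ... | false = refl

length-cartesianProduct : ∀ {A B : Set} (xs : List A) (ys : List B) →
                          length (cartesianProduct xs ys) ≡ length xs * length ys
length-cartesianProduct []       ys = refl
length-cartesianProduct (x ∷ xs) ys = begin
  length (List.map (x ,_) ys List.++ cartesianProduct xs ys)
    ≡⟨ length-++ (List.map (x ,_) ys) ⟩
  length (List.map (x ,_) ys) + length (cartesianProduct xs ys)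
    ≡⟨ cong₂ _+_ (length-map (x ,_) ys) (length-cartesianProduct xs ys) ⟩
  length ys + length xs * length ys
    ∎
  where open ≡-Reasoning

m<o⇒n<p⇒m+n<o*p : ∀ {m n o p} → m < o → n < p → m + n < o * p
m<o⇒n<p⇒m+n<o*p {m} {n} {suc o} {suc p} (s≤s m≤o) (s≤s n≤p) = s≤s (begin
  m + n           ≤⟨ +-mono-≤ m≤o n≤p ⟩
  o + p           ≡⟨ +-comm o p ⟩
  p + o           ≤⟨ +-monoʳ-≤ p (m≤m*n o (suc p)) ⟩
  p + o * suc p   ∎)
  where open ≤-Reasoning

module _ {G H : Graph} (DG : DistanceFunction G) (DH : DistanceFunction H) where
  open DistanceFunction

  □-distance : DistanceFunction (G □ H)
  □-distance = record
    { ∈-verts   = λ { (a , b) → ∈-cartesianProduct⁺ (∈-verts DG a) (∈-verts DH b) }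
    ; δ         = δ□
    ; δ-refl    = λ { (a , b) → cong₂ _+_ (δ-refl DG a) (δ-refl DH b) }
    ; δ≡0⇒≡     = λ { {a , b} {x , y} e →
                    cong₂ _,_ (δ≡0⇒≡ DG (m+n≡0⇒m≡0 _ e)) (δ≡0⇒≡ DH (m+n≡0⇒n≡0 (δ DG a x) e)) }
    ; δ-adj     = adj□
    ; δ-descent = descent□
    ; δ<∣V∣     = λ { (a , b) (x , y) → subst (δ DG a x + δ DH b y <_)
                        (sym (length-cartesianProduct (verts G) (verts H)))
                        (m<o⇒n<p⇒m+n<o*p (δ<∣V∣ DG a x) (δ<∣V∣ DH b y)) }
    }
    where
      δ□ : V (G □ H) → V (G □ H) → ℕ
      δ□ (a , b) (x , y) = δ DG a x + δ DH b y

      adj□ : ∀ {u u'} v → adj (G □ H) u u' ≡ true → δ□ u v ≤ suc (δ□ u' v)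
      adj□ {a , b} {a' , b'} (x , y) e with ∨-true⁻ (adj G a a' ∧ does (_≟V_ H b b')) e
      ... | inj₁ e₁ with ∧-true⁻ (adj G a a') e₁
      ...   | a~a' , b≡b' rewrite does-true⁻ (_≟V_ H b b') b≡b' = +-monoˡ-≤ (δ DH b' y) (δ-adj DG x a~a')
      adj□ {a , b} {a' , b'} (x , y) e | inj₂ e₂ with ∧-true⁻ (does (_≟V_ G a a')) e₂
      ...   | a≡a' , b~b' rewrite does-true⁻ (_≟V_ G a a') a≡a' =
              ≤-trans (+-monoʳ-≤ (δ DG a' x) (δ-adj DH y b~b')) (≤-reflexive (+-suc (δ DG a' x) (δ DH b' y)))

      descent□ : ∀ {u v k} → δ□ u v ≡ suc k → ∃ λ u' → adj (G □ H) u u' ≡ true × δ□ u' v < δ□ u v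
      descent□ {a , b} {x , y} e with δ DG a x in eG
      ... | suc _ with δ-descent DG eG
      ...   | a' , a~a' , lt = (a' , b) , adj-col , +-monoˡ-< (δ DH b y) (subst (δ DG a' x <_) eG lt)
        where
          adj-col : adj (G □ H) (a , b) (a' , b) ≡ true
          adj-col rewrite a~a' | dec-true (_≟V_ H b b) refl = refl
      descent□ {a , b} {x , y} e | zero with δ-descent DH e
      ...   | b' , b~b' , lt = (a , b') , adj-row , subst (λ z → z + δ DH b' y < δ DH b y) (sym eG) lt
        where
          adj-row : adj (G □ H) (a , b) (a , b') ≡ true
          adj-row rewrite b~b' | dec-true (_≟V_ G a a) refl = Bool.∨-zeroʳ _

-- Distances in cycles

cycleDist : ℕ → ℕ → ℕ → ℕ
cycleDist m a b = ∣ a - b ∣ ⊓ (m ∸ ∣ a - b ∣)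

data CycleStep (m : ℕ) : ℕ → ℕ → Set where
  forward       : ∀ {a} → CycleStep m a (suc a)
  backward      : ∀ {a} → CycleStep m (suc a) a
  wrap-backward : ∀ {c} → suc c ≡ m → CycleStep m 0 c
  wrap-forward  : ∀ {a} → suc a ≡ m → CycleStep m a 0

-- cycleAdj m i j unfolds to cycleAdjℕ m (toℕ i) (toℕ j).
cycleAdjℕ : ℕ → ℕ → ℕ → Bool
cycleAdjℕ m a c = (c ≡ᵇ suc a) ∨ (a ≡ᵇ suc c) ∨ ((a ≡ᵇ 0) ∧ (suc c ≡ᵇ m)) ∨ ((c ≡ᵇ 0) ∧ (suc a ≡ᵇ m))

cycleAdjℕ⇒step : ∀ m a c → cycleAdjℕ m a c ≡ true → CycleStep m a c
cycleAdjℕ⇒step m a c e with ∨-true⁻ (c ≡ᵇ suc a) e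
... | inj₁ e₁ rewrite ≡ᵇ-true⁻ c (suc a) e₁ = forward
... | inj₂ e₂ with ∨-true⁻ (a ≡ᵇ suc c) e₂
...   | inj₁ e₃ rewrite ≡ᵇ-true⁻ a (suc c) e₃ = backward
...   | inj₂ e₄ with ∨-true⁻ ((a ≡ᵇ 0) ∧ (suc c ≡ᵇ m)) e₄
...     | inj₁ e₅ with ∧-true⁻ (a ≡ᵇ 0) e₅
...       | a≡0 , c+1≡m rewrite ≡ᵇ-true⁻ a 0 a≡0 = wrap-backward (≡ᵇ-true⁻ (suc c) m c+1≡m)
cycleAdjℕ⇒step m a c e | inj₂ _ | inj₂ _ | inj₂ e₆ with ∧-true⁻ (c ≡ᵇ 0) e₆
...       | c≡0 , a+1≡m rewrite ≡ᵇ-true⁻ c 0 c≡0 = wrap-forward (≡ᵇ-true⁻ (suc a) m a+1≡m)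

step⇒cycleAdjℕ : ∀ {m a c} → CycleStep m a c → cycleAdjℕ m a c ≡ true
step⇒cycleAdjℕ {a = a} forward rewrite ≡ᵇ-refl a = refl
step⇒cycleAdjℕ {a = suc a} backward rewrite ≡ᵇ-refl a = Bool.∨-zeroʳ _
step⇒cycleAdjℕ {c = c} (wrap-backward refl) rewrite ≡ᵇ-refl c = ∨-trueʳ (c ≡ᵇ 1) refl
step⇒cycleAdjℕ {a = a} (wrap-forward refl) rewrite ≡ᵇ-refl a = ∨-trueʳ (a ≡ᵇ 1) (Bool.∨-zeroʳ _)

∣m-n∣<o : ∀ {o m n} → m < o → n < o → ∣ m - n ∣ < o
∣m-n∣<o {o} {m} {n} m<o n<o = ≤-<-trans (∣m-n∣≤m⊔n m n) (⊔-lub m<o n<o)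

∣m-1+m∣≡1 : ∀ m → ∣ m - suc m ∣ ≡ 1
∣m-1+m∣≡1 zero    = refl
∣m-1+m∣≡1 (suc m) = ∣m-1+m∣≡1 m

∣m-n∣≤1+∣1+m-n∣ : ∀ m n → ∣ m - n ∣ ≤ suc ∣ suc m - n ∣
∣m-n∣≤1+∣1+m-n∣ m n = subst (λ z → ∣ m - n ∣ ≤ z + ∣ suc m - n ∣)
                        (∣m-1+m∣≡1 m) (∣-∣-triangle m (suc m) n)

∣1+m-n∣≤1+∣m-n∣ : ∀ m n → ∣ suc m - n ∣ ≤ suc ∣ m - n ∣
∣1+m-n∣≤1+∣m-n∣ m n = subst (λ z → ∣ suc m - n ∣ ≤ z + ∣ m - n ∣)
                        (trans (∣-∣-comm (suc m) m) (∣m-1+m∣≡1 m)) (∣-∣-triangle (suc m) m n)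

m∸n≤1+[m∸o] : ∀ m n o → o ≤ suc n → m ∸ n ≤ suc (m ∸ o)
m∸n≤1+[m∸o] m       n       zero    _         = m≤n⇒m≤1+n (m∸n≤m m n)
m∸n≤1+[m∸o] zero    n       (suc o) _         rewrite 0∸n≡0 n = z≤n
m∸n≤1+[m∸o] (suc m) zero    (suc zero) _      = ≤-refl
m∸n≤1+[m∸o] (suc m) zero    (suc (suc o)) (s≤s ())
m∸n≤1+[m∸o] (suc m) (suc n) (suc o) (s≤s o≤n) = m∸n≤1+[m∸o] m n o o≤n

∣m-n∣≡1+∣1+m-n∣ : ∀ {m n} → m < n → ∣ m - n ∣ ≡ suc ∣ suc m - n ∣
∣m-n∣≡1+∣1+m-n∣ {zero}  {suc n} _         = refl
∣m-n∣≡1+∣1+m-n∣ {suc m} {suc n} (s≤s m<n) = ∣m-n∣≡1+∣1+m-n∣ m<n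

∣1+m-n∣≡1+∣m-n∣ : ∀ {m n} → n ≤ m → ∣ suc m - n ∣ ≡ suc ∣ m - n ∣
∣1+m-n∣≡1+∣m-n∣ {m} {zero}  _         = cong suc (sym (∣-∣-identityʳ m))
∣1+m-n∣≡1+∣m-n∣ {suc m} {suc n} (s≤s n≤m) = ∣1+m-n∣≡1+∣m-n∣ n≤m

1+m∸[m∸n]≡1+n : ∀ {m n} → n ≤ m → suc m ∸ (m ∸ n) ≡ suc n
1+m∸[m∸n]≡1+n {m} {n} n≤m = trans (+-∸-assoc 1 (m∸n≤m m n)) (cong suc (m∸[m∸n]≡n n≤m))

cycleDist-refl : ∀ m a → cycleDist m a a ≡ 0
cycleDist-refl m a rewrite m≡n⇒∣m-n∣≡0 {a} refl = refl

cycleDist-comm : ∀ m a b → cycleDist m a b ≡ cycleDist m b a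
cycleDist-comm m a b rewrite ∣-∣-comm a b = refl

cycleDist< : ∀ {m a b} → a < m → b < m → cycleDist m a b < m
cycleDist< a<m b<m = ≤-<-trans (m⊓n≤m _ _) (∣m-n∣<o a<m b<m)

cycleDist≡0⇒≡ : ∀ {m a b} → a < m → b < m → cycleDist m a b ≡ 0 → a ≡ b
cycleDist≡0⇒≡ {m} {a} {b} a<m b<m e with ≤-total ∣ a - b ∣ (m ∸ ∣ a - b ∣)
... | inj₁ le = ∣m-n∣≡0⇒m≡n (trans (sym (m≤n⇒m⊓n≡m le)) e)
... | inj₂ ge = ⊥-elim (<⇒≱ (∣m-n∣<o a<m b<m) (m∸n≡0⇒m≤n (trans (sym (m≥n⇒m⊓n≡n ge)) e)))

cycleDist-near : ∀ {m a b} → ∣ a - b ∣ + ∣ a - b ∣ ≤ m → cycleDist m a b ≡ ∣ a - b ∣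
cycleDist-near {m} {a} {b} small = m≤n⇒m⊓n≡m (m+n≤o⇒m≤o∸n ∣ a - b ∣ small)

cycleDist-far : ∀ {m a b} → ∣ a - b ∣ ≤ m → m ≤ ∣ a - b ∣ + ∣ a - b ∣ → cycleDist m a b ≡ m ∸ ∣ a - b ∣
cycleDist-far {m} {a} {b} _ large = m≥n⇒m⊓n≡n (m≤n+o⇒m∸n≤o m ∣ a - b ∣ large)

cycleDist-wrap : ∀ {c b} → b ≤ c → cycleDist (suc c) c b ≡ (c ∸ b) ⊓ suc b
cycleDist-wrap {c} {b} b≤c rewrite m≤n⇒∣n-m∣≡n∸m b≤c | 1+m∸[m∸n]≡1+n b≤c = refl

cycleDist-step : ∀ {m a c} b → b < m → CycleStep m a c → cycleDist m a b ≤ suc (cycleDist m c b)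
cycleDist-step {m} {a} b _ forward =
  ⊓-mono-≤ (∣m-n∣≤1+∣1+m-n∣ a b) (m∸n≤1+[m∸o] m _ _ (∣1+m-n∣≤1+∣m-n∣ a b))
cycleDist-step {m} {suc c} b _ backward =
  ⊓-mono-≤ (∣1+m-n∣≤1+∣m-n∣ c b) (m∸n≤1+[m∸o] m _ _ (∣m-n∣≤1+∣1+m-n∣ c b))
cycleDist-step {c = c} b (s≤s b≤c) (wrap-backward refl) rewrite cycleDist-wrap b≤c =
  ≤-trans (≤-reflexive (⊓-comm b _))
          (⊓-mono-≤ (≤-reflexive (+-∸-assoc 1 b≤c)) (≤-trans (n≤1+n b) (n≤1+n (suc b))))
cycleDist-step {a = a} b (s≤s b≤a) (wrap-forward refl) rewrite cycleDist-wrap b≤a =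
  ≤-trans (⊓-mono-≤ (≤-trans (∸-monoˡ-≤ b (n≤1+n a)) (n≤1+n _)) ≤-refl)
          (≤-reflexive (cong suc (⊓-comm _ b)))

module _ (m a b c : ℕ) where

  shrink-inner : ∣ a - b ∣ ≤ m ∸ ∣ a - b ∣ → ∣ c - b ∣ < ∣ a - b ∣ → cycleDist m c b < cycleDist m a b
  shrink-inner inner lt = ≤-<-trans (m⊓n≤m _ _) (subst (_ <_) (sym (m≤n⇒m⊓n≡m inner)) lt)

  shrink-outer : m ∸ ∣ a - b ∣ ≤ ∣ a - b ∣ → m ∸ ∣ c - b ∣ < m ∸ ∣ a - b ∣ → cycleDist m c b < cycleDist m a b
  shrink-outer outer lt = ≤-<-trans (m⊓n≤n _ _) (subst (_ <_) (sym (m≥n⇒m⊓n≡n outer)) lt)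

  cross-outer : m ∸ ∣ a - b ∣ ≤ ∣ a - b ∣ → ∣ c - b ∣ < m ∸ ∣ a - b ∣ → cycleDist m c b < cycleDist m a b
  cross-outer outer lt = ≤-<-trans (m⊓n≤m _ _) (subst (_ <_) (sym (m≥n⇒m⊓n≡n outer)) lt)

-- Step along the shorter arc: towards b if that arc is the direct one (∣ a - b ∣), away from b,
-- possibly wrapping around, if it is the one through 0.
cycleDist-descent : ∀ {m a b} → a < m → b < m → 0 < cycleDist m a b →
                    ∃ λ c → c < m × CycleStep m a c × cycleDist m c b < cycleDist m a b
cycleDist-descent {m} {a} {b} a<m b<m pos with ≤-total ∣ a - b ∣ (m ∸ ∣ a - b ∣) | <-cmp a b
... | _ | tri≈ _ refl _ = ⊥-elim (<⇒≱ pos (≤-reflexive (cycleDist-refl m a)))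
... | inj₁ inner | tri< a<b _ _ =
  suc a , ≤-<-trans a<b b<m , forward , shrink-inner m a b (suc a) inner (≤-reflexive (sym (∣m-n∣≡1+∣1+m-n∣ a<b)))
cycleDist-descent {m} {suc a} {b} a<m b<m pos | inj₁ inner | tri> _ _ b<a =
  a , <-trans (n<1+n a) a<m , backward ,
  shrink-inner m (suc a) b a inner (≤-reflexive (sym (∣1+m-n∣≡1+∣m-n∣ (≤-pred b<a))))
cycleDist-descent {suc m} {zero} {b} a<m (s≤s b≤m) pos | inj₂ outer | tri< a<b _ _ =
  m , ≤-refl , wrap-backward refl ,
  cross-outer (suc m) 0 b m outer (subst₂ _<_ (sym (m≤n⇒∣n-m∣≡n∸m b≤m)) (sym (+-∸-assoc 1 b≤m)) ≤-refl)
cycleDist-descent {m} {suc a} {b} a<m b<m pos | inj₂ outer | tri< a<b _ _ =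
  a , <-trans (n<1+n a) a<m , backward , shrink-outer m (suc a) b a outer
    (∸-monoʳ-< (≤-reflexive (sym (∣m-n∣≡1+∣1+m-n∣ (<-trans (n<1+n a) a<b))))
               (<⇒≤ (∣m-n∣<o (<-trans (n<1+n a) a<m) b<m)))
... | inj₂ outer | tri> _ _ b<a with suc a <? m
...   | yes 1+a<m = suc a , 1+a<m , forward ,
        shrink-outer m a b (suc a) outer
          (∸-monoʳ-< (≤-reflexive (sym (∣1+m-n∣≡1+∣m-n∣ (<⇒≤ b<a)))) (<⇒≤ (∣m-n∣<o 1+a<m b<m)))
...   | no  1+a≮m = 0 , ≤-<-trans z≤n a<m , wrap-forward 1+a≡m ,
        cross-outer m a b 0 outer (subst (b <_) (sym m∸∣a-b∣≡1+b) ≤-refl)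
  where 1+a≡m : suc a ≡ m
        1+a≡m = ≤-antisym a<m (≮⇒≥ 1+a≮m)
        m∸∣a-b∣≡1+b : m ∸ ∣ a - b ∣ ≡ suc b
        m∸∣a-b∣≡1+b rewrite sym 1+a≡m | m≤n⇒∣n-m∣≡n∸m (<⇒≤ b<a) = 1+m∸[m∸n]≡1+n (<⇒≤ b<a)

cycleDistance : (m : ℕ) → DistanceFunction (Cycle m)
cycleDistance m = record
  { ∈-verts   = ∈-allFin
  ; δ         = λ i j → cycleDist m (toℕ i) (toℕ j)
  ; δ-refl    = λ i → cycleDist-refl m (toℕ i)
  ; δ≡0⇒≡     = λ {i} {j} e → toℕ-injective (cycleDist≡0⇒≡ (toℕ<n i) (toℕ<n j) e)
  ; δ-adj     = λ {i} {i'} j e → cycleDist-step (toℕ j) (toℕ<n j) (cycleAdjℕ⇒step m (toℕ i) (toℕ i') e)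
  ; δ-descent = descent
  ; δ<∣V∣     = λ i j → subst (cycleDist m (toℕ i) (toℕ j) <_) (sym (length-tabulate {n = m} (λ k → k)))
                               (cycleDist< (toℕ<n i) (toℕ<n j))
  }
  where
    descent : ∀ {i j k} → cycleDist m (toℕ i) (toℕ j) ≡ suc k →
              ∃ λ i' → cycleAdj m i i' ≡ true × cycleDist m (toℕ i') (toℕ j) < cycleDist m (toℕ i) (toℕ j)
    descent {i} {j} e with cycleDist-descent (toℕ<n i) (toℕ<n j) (subst (0 <_) (sym e) (s≤s z≤n))
    ... | c , c<m , step , shorter rewrite sym (toℕ-fromℕ< c<m) =
      fromℕ< c<m , step⇒cycleAdjℕ step , shorter

module _ (n : ℕ) .{{_ : NonZero n}} where

  [m%n+k]%n≡[m+k]%n : ∀ m k → (m % n + k) % n ≡ (m + k) % n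
  [m%n+k]%n≡[m+k]%n m k = begin
    (m % n + k) % n          ≡⟨ %-distribˡ-+ (m % n) k n ⟩
    (m % n % n + k % n) % n  ≡⟨ cong (λ z → (z + k % n) % n) (m%n%n≡m%n m n) ⟩
    (m % n + k % n) % n      ≡⟨ %-distribˡ-+ m k n ⟨
    (m + k) % n              ∎
    where open ≡-Reasoning

  cycleDist-+% : ∀ {a d} → a < n → d + d ≤ n → cycleDist n a ((a + d) % n) ≡ d
  cycleDist-+% {a} {d} a<n 2d≤n with a + d <? n
  ... | yes a+d<n rewrite m<n⇒m%n≡m a+d<n | m≤n⇒∣m-n∣≡n∸m (m≤m+n a d) | m+n∸m≡n a d =
    m≤n⇒m⊓n≡m (m+n≤o⇒m≤o∸n d 2d≤n)
  ... | no  a+d≮n = goal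
    where
      n≤a+d : n ≤ a + d
      n≤a+d = ≮⇒≥ a+d≮n
      d≤n : d ≤ n
      d≤n = m+n≤o⇒m≤o d 2d≤n
      c = a + d ∸ n
      a≡n∸d+c : a ≡ (n ∸ d) + c
      a≡n∸d+c = +-cancelʳ-≡ d _ _ (begin
        a + d              ≡⟨ m+[n∸m]≡n n≤a+d ⟨
        n + c              ≡⟨ cong (_+ c) (m∸n+n≡m d≤n) ⟨
        n ∸ d + d + c      ≡⟨ +-assoc (n ∸ d) d c ⟩
        n ∸ d + (d + c)    ≡⟨ cong (n ∸ d +_) (+-comm d c) ⟩
        n ∸ d + (c + d)    ≡⟨ +-assoc (n ∸ d) c d ⟨
        n ∸ d + c + d      ∎)
        where open ≡-Reasoning
      c≤a : c ≤ a
      c≤a = subst (c ≤_) (sym a≡n∸d+c) (m≤n+m c (n ∸ d))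
      wrapped : (a + d) % n ≡ c
      wrapped = trans (sym (m≤n⇒[n∸m]%m≡n%m n≤a+d)) (m<n⇒m%n≡m (≤-<-trans c≤a a<n))
      ∣a-c∣≡n∸d : ∣ a - c ∣ ≡ n ∸ d
      ∣a-c∣≡n∸d = trans (m≤n⇒∣n-m∣≡n∸m c≤a) (trans (cong (_∸ c) a≡n∸d+c) (m+n∸n≡m (n ∸ d) c))
      goal : cycleDist n a ((a + d) % n) ≡ d
      goal rewrite wrapped | ∣a-c∣≡n∸d | m∸[m∸n]≡n d≤n = m≥n⇒m⊓n≡n (m+n≤o⇒m≤o∸n d 2d≤n)

  cycleDist-shift-≤ : ∀ e {a b} → a ≤ b → ∣ a - b ∣ + ∣ a - b ∣ ≤ n →
                      cycleDist n ((e + a) % n) ((e + b) % n) ≡ ∣ a - b ∣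
  cycleDist-shift-≤ e {a} {b} a≤b small rewrite m≤n⇒∣m-n∣≡n∸m a≤b = begin
    cycleDist n ((e + a) % n) ((e + b) % n)                 ≡⟨ cong (cycleDist n ((e + a) % n)) shift ⟩
    cycleDist n ((e + a) % n) (((e + a) % n + (b ∸ a)) % n) ≡⟨ cycleDist-+% (m%n<n (e + a) n) small ⟩
    b ∸ a                                                   ∎
    where
      open ≡-Reasoning
      shift : (e + b) % n ≡ ((e + a) % n + (b ∸ a)) % n
      shift = begin
        (e + b) % n                 ≡⟨ cong (λ z → (e + z) % n) (m+[n∸m]≡n a≤b) ⟨
        (e + (a + (b ∸ a))) % n     ≡⟨ cong (_% n) (+-assoc e a (b ∸ a)) ⟨
        (e + a + (b ∸ a)) % n       ≡⟨ [m%n+k]%n≡[m+k]%n (e + a) (b ∸ a) ⟨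
        ((e + a) % n + (b ∸ a)) % n ∎

  cycleDist-shift : ∀ e a b → ∣ a - b ∣ + ∣ a - b ∣ ≤ n →
                    cycleDist n ((e + a) % n) ((e + b) % n) ≡ ∣ a - b ∣
  cycleDist-shift e a b small with ≤-total a b
  ... | inj₁ a≤b = cycleDist-shift-≤ e a≤b small
  ... | inj₂ b≤a rewrite cycleDist-comm n ((e + a) % n) ((e + b) % n) | ∣-∣-comm a b =
    cycleDist-shift-≤ e b≤a small

  cycleStep-% : ∀ {a c} → a < n → c < n → CycleStep n a c → c ≡ (a + 1) % n ⊎ a ≡ (c + 1) % n
  cycleStep-% {a}     _   c<n forward       = inj₁ (sym (trans (cong (_% n) (+-comm a 1)) (m<n⇒m%n≡m c<n)))
  cycleStep-% {c = c} a<n _   backward      = inj₂ (sym (trans (cong (_% n) (+-comm c 1)) (m<n⇒m%n≡m a<n)))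
  cycleStep-% {c = c} _   _   (wrap-backward c+1≡n) =
    inj₂ (sym (trans (cong (_% n) (trans (+-comm c 1) c+1≡n)) (n%n≡0 n)))
  cycleStep-% {a}     _   _   (wrap-forward a+1≡n) =
    inj₁ (sym (trans (cong (_% n) (trans (+-comm a 1) a+1≡n)) (n%n≡0 n)))

  [m+1]%n≡[k+1]%n⇒m≡k%n : ∀ {m k} → m < n → (m + 1) % n ≡ (k + 1) % n → m ≡ k % n
  [m+1]%n≡[k+1]%n⇒m≡k%n {m} {k} m<n eq = begin
    m                            ≡⟨ m<n⇒m%n≡m m<n ⟨
    m % n                        ≡⟨ shift-back m ⟨
    ((m + 1) % n + (n ∸ 1)) % n  ≡⟨ cong (λ z → (z + (n ∸ 1)) % n) eq ⟩
    ((k + 1) % n + (n ∸ 1)) % n  ≡⟨ shift-back k ⟩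
    k % n                        ∎
    where
      open ≡-Reasoning
      shift-back : ∀ x → ((x + 1) % n + (n ∸ 1)) % n ≡ x % n
      shift-back x = begin
        ((x + 1) % n + (n ∸ 1)) % n  ≡⟨ [m%n+k]%n≡[m+k]%n (x + 1) (n ∸ 1) ⟩
        (x + 1 + (n ∸ 1)) % n        ≡⟨ cong (_% n) (+-assoc x 1 (n ∸ 1)) ⟩
        (x + (1 + (n ∸ 1))) % n      ≡⟨ cong (λ z → (x + z) % n) (m+[n∸m]≡n (>-nonZero⁻¹ n)) ⟩
        (x + n) % n                  ≡⟨ [m+n]%n≡m%n x n ⟩
        x % n                        ∎

-- One cop does not suffice on G □ C₆

rotate : ℕ → Fin 6 → Fin 6
rotate k j = (toℕ j + k) mod 6

-- The rows r with d(r, y) = d(r + 2, y) are y - 1 and y + 2; they are antipodal, so one of them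
-- is within distance 1 of any row.
dodge : Fin 6 → Fin 6 → Fin 6
dodge r y = if cycleDist 6 (toℕ r) (toℕ (rotate 5 y)) ≤ᵇ 1 then rotate 5 y else rotate 2 y

dodge-blind : ∀ r y → cycleDist 6 (toℕ (dodge r y)) (toℕ y) ≡ cycleDist 6 (toℕ (rotate 2 (dodge r y))) (toℕ y)
dodge-blind = decide₂ λ r y → _ ≟ _

dodge-step : ∀ r y → dodge r y ≡ r ⊎ cycleAdj 6 r (dodge r y) ≡ true
dodge-step = decide₂ λ r y → (_ Fin.≟ _) ⊎-dec (_ Bool.≟ _)

rotate2-adj : ∀ r s → cycleAdj 6 (rotate 2 r) (rotate 2 s) ≡ cycleAdj 6 r s
rotate2-adj = decide₂ λ r s → _ Bool.≟ _

rotate2-≢ : ∀ r → rotate 2 r ≢ r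
rotate2-≢ = decide₁ λ r → ¬? (_ Fin.≟ _)

module _ {G : Graph} (DG : DistanceFunction G) (c : V G) (σ : Strategy (G □ Cycle 6) 1) where

  probedRow : List (Vec ℕ 1) → Fin 6
  probedRow h = proj₂ (head (σ h))

  answer : Fin 6 → List (Vec ℕ 1) → Vec ℕ 1
  answer r h = map (dist (G □ Cycle 6) (c , r)) (σ h)

  row     : ℕ → Fin 6
  answers : ℕ → List (Vec ℕ 1)

  row zero    = dodge Fin.zero (probedRow (answers zero))
  row (suc t) = dodge (row t) (probedRow (answers (suc t)))

  answers zero    = []
  answers (suc t) = answer (row t) (answers t) ∷ answers t

  robber shadow : ℕ → V (G □ Cycle 6)
  robber t = c , row t
  shadow t = c , rotate 2 (row t)

  row-blind : ∀ t → let y = toℕ (probedRow (answers t)) in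
              cycleDist 6 (toℕ (row t)) y ≡ cycleDist 6 (toℕ (rotate 2 (row t))) y
  row-blind zero    = dodge-blind Fin.zero (probedRow (answers zero))
  row-blind (suc t) = dodge-blind (row t) (probedRow (answers (suc t)))

  answer-blind : ∀ (v : Vec (V (G □ Cycle 6)) 1) r → let y = toℕ (proj₂ (head v)) in
                 cycleDist 6 (toℕ r) y ≡ cycleDist 6 (toℕ (rotate 2 r)) y →
                 map (dist (G □ Cycle 6) (c , rotate 2 r)) v ≡ map (dist (G □ Cycle 6) (c , r)) v
  answer-blind ((b , y) ∷ []) r blind
    rewrite dist≡δ (□-distance DG (cycleDistance 6)) (c , rotate 2 r) (b , y)
          | dist≡δ (□-distance DG (cycleDistance 6)) (c , r) (b , y)
          | blind = refl

  robber-history : ∀ t → history (G □ Cycle 6) σ robber t ≡ answers t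
  robber-history zero    = refl
  robber-history (suc t) rewrite robber-history t = refl

  shadow-history : ∀ t → history (G □ Cycle 6) σ shadow t ≡ answers t
  shadow-history zero    = refl
  shadow-history (suc t) rewrite shadow-history t =
    cong (_∷ answers t) (answer-blind (σ (answers t)) (row t) (row-blind t))

  row-step : ∀ r r' → r' ≡ r ⊎ cycleAdj 6 r r' ≡ true →
             (c , r') ≡ (c , r) ⊎ adj (G □ Cycle 6) (c , r) (c , r') ≡ true
  row-step r r' (inj₁ r'≡r) = inj₁ (cong (c ,_) r'≡r)
  row-step r r' (inj₂ r~r') rewrite dec-true (_≟V_ G c c) refl | r~r' = inj₂ (Bool.∨-zeroʳ _)

  robber-walk : IsWalk (G □ Cycle 6) robber
  robber-walk t = row-step (row t) (row (suc t)) (dodge-step (row t) (probedRow (answers (suc t))))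

  shadow-walk : IsWalk (G □ Cycle 6) shadow
  shadow-walk t = row-step (rotate 2 (row t)) (rotate 2 (row (suc t)))
                           (shadow-step (dodge-step (row t) (probedRow (answers (suc t)))))
    where
      shadow-step : ∀ {r r'} → r' ≡ r ⊎ cycleAdj 6 r r' ≡ true →
                    rotate 2 r' ≡ rotate 2 r ⊎ cycleAdj 6 (rotate 2 r) (rotate 2 r') ≡ true
      shadow-step (inj₁ refl) = inj₁ refl
      shadow-step {r} {r'} (inj₂ r~r') = inj₂ (trans (rotate2-adj r r') r~r')

□C₆-oneCopLoses : ∀ {G} → DistanceFunction G → V G → ¬ CopWins (G □ Cycle 6) 1
□C₆-oneCopLoses DG c (σ , wins) with wins (robber DG c σ) (robber-walk DG c σ)
... | t , located = rotate2-≢ (row DG c σ t) (cong proj₂ (located (shadow DG c σ) (shadow-walk DG c σ)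
        (trans (shadow-history DG c σ (suc t)) (sym (robber-history DG c σ (suc t))))))

-- The local game

LPos : Set
LPos = ℕ × Fin 6

localDist : LPos → LPos → ℕ
localDist (L , j) (a , y) = ∣ L - a ∣ + cycleDist 6 (toℕ j) (toℕ y)

localAnswers : Vec LPos 2 → LPos → Vec ℕ 2
localAnswers (q ∷ q' ∷ []) x = localDist x q ∷ localDist x q' ∷ []

-- After the first probe the Robber is known to be at start j for some row j.
start : Fin 6 → LPos
start j = 5 ∸ cycleDist 6 (toℕ j) 0 , j

move : Fin 5 → LPos → LPos
move k (L , j) with toℕ k
... | 0 = L , j
... | 1 = suc L , j
... | 2 = pred L , j
... | 3 = L , rotate 1 j
... | _ = L , rotate 5 j

antipodes : ℕ → Fin 6 → Vec LPos 2
antipodes L y = (L , y) ∷ (L , rotate 3 y) ∷ []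

probe₁ : Vec LPos 2
probe₁ = (3 , # 2) ∷ (4 , # 1) ∷ []

probe₂ : Vec ℕ 2 → Vec LPos 2
probe₂ (0 ∷ 2 ∷ []) = antipodes 2 (# 0)
probe₂ (1 ∷ 1 ∷ []) = antipodes 2 (# 0)
probe₂ (1 ∷ 3 ∷ []) = antipodes 1 (# 1)
probe₂ (2 ∷ 0 ∷ []) = antipodes 3 (# 0)
probe₂ (2 ∷ 4 ∷ []) = antipodes 1 (# 2)
probe₂ (3 ∷ 1 ∷ []) = antipodes 3 (# 2)
probe₂ (3 ∷ 3 ∷ []) = antipodes 2 (# 0)
probe₂ (3 ∷ 5 ∷ []) = antipodes 0 (# 2)
probe₂ (4 ∷ 2 ∷ []) = antipodes 3 (# 1)
probe₂ (5 ∷ 3 ∷ []) = antipodes 4 (# 1)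
probe₂ _            = probe₁  -- answers that cannot occur

trajectories : List (LPos × LPos)
trajectories = concatMap (λ j → concatMap (λ k₁ → let x₁ = move k₁ (start j) in
                 List.map (λ k₂ → x₁ , move k₂ x₁) (allFin 5)) (allFin 5)) (allFin 6)

-- The endpoint of the first two-step trajectory consistent with both answers; local-strategy-locates
-- shows that it is always the true one.
locate : Vec ℕ 2 → Vec ℕ 2 → LPos
locate a₁ a₂ = fromMaybe (0 , # 0) (Maybe.map proj₂ (findᵇ consistent trajectories))
  where consistent : LPos × LPos → Bool
        consistent (x₁ , x₂) = does (Vec.≡-dec _≟_ (localAnswers probe₁ x₁) a₁)
                             ∧ does (Vec.≡-dec _≟_ (localAnswers (probe₂ a₁) x₂) a₂)

Interior : LPos → Set
Interior (L , _) = 1 ≤ L × L ≤ 6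

Near : LPos → LPos → Set
Near (L , _) (a , _) = L ≤ 7 × a ≤ 7 × ∣ L - a ∣ ≤ 3

NearBoth : LPos → Vec LPos 2 → Set
NearBoth x (q ∷ q' ∷ []) = Near x q × Near x q'

Locates : LPos → LPos → Set
Locates x₁ x₂ = NearBoth x₁ probe₁ × NearBoth x₂ P₂ × locate a₁ (localAnswers P₂ x₂) ≡ x₂
  where a₁ = localAnswers probe₁ x₁
        P₂ = probe₂ a₁

interior? : ∀ x → Dec (Interior x)
interior? (L , _) = (1 ≤? L) ×-dec (L ≤? 6)

near? : ∀ x q → Dec (Near x q)
near? (L , _) (a , _) = (L ≤? 7) ×-dec (a ≤? 7) ×-dec (∣ L - a ∣ ≤? 3)

nearBoth? : ∀ x P → Dec (NearBoth x P)
nearBoth? x (q ∷ q' ∷ []) = near? x q ×-dec near? x q'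

locates? : ∀ x₁ x₂ → Dec (Locates x₁ x₂)
locates? x₁ x₂ = nearBoth? x₁ probe₁ ×-dec nearBoth? x₂ P₂
                 ×-dec ≡-dec _≟_ Fin._≟_ (locate a₁ (localAnswers P₂ x₂)) x₂
  where a₁ = localAnswers probe₁ x₁
        P₂ = probe₂ a₁

start-interior : ∀ j → Interior (start j)
start-interior = decide₁ λ j → interior? (start j)

step-interior : ∀ j k → Interior (move k (start j))
step-interior = decide₂ λ j k → interior? (move k (start j))

local-strategy-locates : ∀ j k₁ k₂ → Locates (move k₁ (start j)) (move k₂ (move k₁ (start j)))
local-strategy-locates = decide₃ λ j k₁ k₂ → locates? (move k₁ (start j)) (move k₂ (move k₁ (start j)))

-- Two cops win on C₂ₚ □ C₆

∣m∸a-m∸b∣≡∣a-b∣ : ∀ {m a b} → a ≤ m → b ≤ m → ∣ m ∸ a - m ∸ b ∣ ≡ ∣ a - b ∣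
∣m∸a-m∸b∣≡∣a-b∣ {m} {zero}  {b}     _ b≤m = trans (m≤n⇒∣n-m∣≡n∸m (m∸n≤m m b)) (m∸[m∸n]≡n b≤m)
∣m∸a-m∸b∣≡∣a-b∣ {m} {suc a} {zero}  a≤m _ = trans (m≤n⇒∣m-n∣≡n∸m (m∸n≤m m (suc a))) (m∸[m∸n]≡n a≤m)
∣m∸a-m∸b∣≡∣a-b∣ {suc m} {suc a} {suc b} (s≤s a≤m) (s≤s b≤m) = ∣m∸a-m∸b∣≡∣a-b∣ a≤m b≤m

data Orientation : Set where
  up down : Orientation

orient : Orientation → ℕ → ℕ
orient up   L = L
orient down L = 7 ∸ L

∣orient-orient∣ : ∀ o {L a} → L ≤ 7 → a ≤ 7 → ∣ orient o L - orient o a ∣ ≡ ∣ L - a ∣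
∣orient-orient∣ up   _   _   = refl
∣orient-orient∣ down L≤7 a≤7 = ∣m∸a-m∸b∣≡∣a-b∣ L≤7 a≤7

module Torus (p : ℕ) (3≤p : 3 ≤ p) where

  n : ℕ
  n = 2 * p

  6≤n : 6 ≤ n
  6≤n = *-monoʳ-≤ 2 3≤p

  4≤n : 4 ≤ n
  4≤n = ≤-trans (s≤s (s≤s (s≤s (s≤s z≤n)))) 6≤n

  twice-≤ : ∀ {a} → a ≤ p → a + a ≤ n
  twice-≤ {a} a≤p = subst (a + a ≤_) (cong (p +_) (sym (+-identityʳ p))) (+-mono-≤ a≤p a≤p)

  twice-≥ : ∀ {a} → p ≤ a → n ≤ a + a
  twice-≥ {a} p≤a = subst (_≤ a + a) (cong (p +_) (sym (+-identityʳ p))) (+-mono-≤ p≤a p≤a)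

  instance
    n-nonZero : NonZero n
    n-nonZero = >-nonZero (≤-trans (s≤s z≤n) 6≤n)

  G : Graph
  G = Cycle n □ Cycle 6

  dist-G : ∀ u j x y → dist G (u , j) (x , y) ≡ cycleDist n (toℕ u) (toℕ x) + cycleDist 6 (toℕ j) (toℕ y)
  dist-G u j x y = dist≡δ (□-distance (cycleDistance n) (cycleDistance 6)) (u , j) (x , y)

  -- A frame (o , e) puts local column L at torus column e + orient o L; the reflected orientation
  -- serves a Robber found on the other side of column 0.
  Frame : Set
  Frame = Orientation × ℕ

  frameColumn : Frame → ℕ → ℕ
  frameColumn (o , e) L = (e + orient o L) % n

  embed : Frame → LPos → V G
  embed (o , e) (L , j) = (e + orient o L) mod n , j

  record Represents (f : Frame) (x : LPos) (w : V G) : Set where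
    constructor represents
    field
      column-≡ : toℕ (proj₁ w) ≡ frameColumn f (proj₁ x)
      row-≡    : proj₂ w ≡ proj₂ x

  represents⇒embed : ∀ {f x w} → Represents f x w → embed f x ≡ w
  represents⇒embed {x = L , j} {u , k} (represents u≡ refl) =
    cong (_, k) (toℕ-injective (trans (toℕ-fromℕ< _) (sym u≡)))

  dist-embed : ∀ {f x w} q → Represents f x w → Near x q → dist G w (embed f q) ≡ localDist x q
  dist-embed {o , e} {L , j} {u , k} (a , y) (represents u≡ refl) (L≤7 , a≤7 , close) = begin
    dist G (u , j) ((e + orient o a) mod n , y)
      ≡⟨ dist-G u j _ y ⟩
    cycleDist n (toℕ u) (toℕ ((e + orient o a) mod n)) + cycleDist 6 (toℕ j) (toℕ y)
      ≡⟨ cong₂ (λ s t → cycleDist n s t + cycleDist 6 (toℕ j) (toℕ y)) u≡ (toℕ-fromℕ< _) ⟩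
    cycleDist n ((e + orient o L) % n) ((e + orient o a) % n) + cycleDist 6 (toℕ j) (toℕ y)
      ≡⟨ cong (_+ cycleDist 6 (toℕ j) (toℕ y)) (cycleDist-shift n e _ _ small) ⟩
    ∣ orient o L - orient o a ∣ + cycleDist 6 (toℕ j) (toℕ y)
      ≡⟨ cong (_+ cycleDist 6 (toℕ j) (toℕ y)) (∣orient-orient∣ o L≤7 a≤7) ⟩
    localDist (L , j) (a , y)
      ∎
    where
      open ≡-Reasoning
      small : ∣ orient o L - orient o a ∣ + ∣ orient o L - orient o a ∣ ≤ n
      small rewrite ∣orient-orient∣ o L≤7 a≤7 = ≤-trans (+-mono-≤ close close) 6≤n

  answers-embed : ∀ {f x w} P → Represents f x w → NearBoth x P → map (dist G w) (map (embed f) P) ≡ localAnswers P x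
  answers-embed (q ∷ q' ∷ []) r (near , near') =
    cong₂ (λ d d' → d ∷ d' ∷ []) (dist-embed q r near) (dist-embed q' r near')

  -- d₂ < d₁ exactly when the Robber's column u satisfies 1 ≤ u ≤ p; either way the frame puts u at
  -- local column 5 ∸ d(j, 0) (anchor-correct).
  anchor : Vec ℕ 2 → Frame
  anchor (d₁ ∷ d₂ ∷ []) = if does (d₂ <? d₁) then (up , d₂ + (n ∸ 4)) else (down , (n + n) ∸ (d₁ + 2))

  7∸[5∸b]≡b+2 : ∀ {b} → b ≤ 3 → 7 ∸ (5 ∸ b) ≡ b + 2
  7∸[5∸b]≡b+2 z≤n                   = refl
  7∸[5∸b]≡b+2 (s≤s z≤n)             = refl
  7∸[5∸b]≡b+2 (s≤s (s≤s z≤n))       = refl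
  7∸[5∸b]≡b+2 (s≤s (s≤s (s≤s z≤n))) = refl

  anchor-right : ∀ {a b} → suc a < n → b ≤ 3 → suc a ≡ (a + b + (n ∸ 4) + (5 ∸ b)) % n
  anchor-right {a} {b} a<n b≤3 = sym (begin
    (a + b + (n ∸ 4) + (5 ∸ b)) % n   ≡⟨ cong (_% n) sum≡ ⟩
    (suc a + n) % n                   ≡⟨ [m+n]%n≡m%n (suc a) n ⟩
    suc a % n                         ≡⟨ m<n⇒m%n≡m a<n ⟩
    suc a                             ∎)
    where
      open ≡-Reasoning
      sum≡ : a + b + (n ∸ 4) + (5 ∸ b) ≡ suc a + n
      sum≡ = begin
        a + b + (n ∸ 4) + (5 ∸ b)
          ≡⟨ solve 4 (λ a b m c → a :+ b :+ m :+ c := a :+ m :+ (b :+ c)) refl a b (n ∸ 4) (5 ∸ b) ⟩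
        a + (n ∸ 4) + (b + (5 ∸ b))
          ≡⟨ cong (a + (n ∸ 4) +_) (m+[n∸m]≡n (≤-trans b≤3 (s≤s (s≤s (s≤s z≤n))))) ⟩
        a + (n ∸ 4) + 5
          ≡⟨ solve 2 (λ a m → a :+ m :+ con 5 := con 1 :+ a :+ (con 4 :+ m)) refl a (n ∸ 4) ⟩
        suc a + (4 + (n ∸ 4))
          ≡⟨ cong (suc a +_) (m+[n∸m]≡n 4≤n) ⟩
        suc a + n
          ∎

  anchor-left : ∀ {k b} → k ≤ n → b ≤ 3 → n + n ∸ (k + b + 2) + (7 ∸ (5 ∸ b)) ≡ n + (n ∸ k)
  anchor-left {k} {b} k≤n b≤3 = begin
    n + n ∸ (k + b + 2) + (7 ∸ (5 ∸ b))   ≡⟨ cong₂ (λ s t → n + n ∸ s + t) (+-assoc k b 2) (7∸[5∸b]≡b+2 b≤3) ⟩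
    n + n ∸ (k + (b + 2)) + (b + 2)       ≡⟨ cong (_+ (b + 2)) (∸-+-assoc (n + n) k (b + 2)) ⟨
    n + n ∸ k ∸ (b + 2) + (b + 2)         ≡⟨ m∸n+n≡m b+2≤ ⟩
    n + n ∸ k                             ≡⟨ +-∸-assoc n k≤n ⟩
    n + (n ∸ k)                           ∎
    where
      open ≡-Reasoning
      b+2≤ : b + 2 ≤ n + n ∸ k
      b+2≤ = ≤-trans (+-monoˡ-≤ 2 b≤3) (≤-trans (≤-trans (n≤1+n 5) 6≤n)
               (subst (n ≤_) (sym (+-∸-assoc n k≤n)) (m≤m+n n (n ∸ k))))

  right-answers : ∀ {a} → suc a ≤ p → cycleDist n (suc a) 0 ≡ suc a × cycleDist n (suc a) 1 ≡ a
  right-answers {a} a<p = cycleDist-near {n} {suc a} {0} (twice-≤ a<p) ,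
    trans (cycleDist-near {n} {suc a} {1} (subst (λ z → z + z ≤ n) (sym ∣a-0∣≡a) (twice-≤ (<⇒≤ a<p)))) ∣a-0∣≡a
    where ∣a-0∣≡a = ∣-∣-identityʳ a

  left-answers : ∀ {a} → p ≤ a → suc a < n → cycleDist n (suc a) 0 ≡ n ∸ suc a × cycleDist n (suc a) 1 ≡ n ∸ a
  left-answers {a} p≤a a<n = cycleDist-far {n} {suc a} {0} (<⇒≤ a<n) (twice-≥ (≤-trans p≤a (n≤1+n a))) ,
    trans (cycleDist-far {n} {suc a} {1} (subst (_≤ n) (sym ∣a-0∣≡a) (≤-trans (n≤1+n a) (<⇒≤ a<n)))
                         (subst (λ z → n ≤ z + z) (sym ∣a-0∣≡a) (twice-≥ p≤a)))
          (cong (n ∸_) ∣a-0∣≡a)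
    where ∣a-0∣≡a = ∣-∣-identityʳ a

  anchor-correct : ∀ {a b} → a < n → b ≤ 3 →
                   a ≡ frameColumn (anchor (cycleDist n a 0 + b ∷ cycleDist n a 1 + b ∷ [])) (5 ∸ b)
  anchor-correct {zero} {b} _ b≤3
    rewrite cycleDist-near {n} {0} {1} (≤-trans (s≤s (s≤s z≤n)) 6≤n) | dec-false (suc b <? b) (<-asym (n<1+n b)) =
    sym (begin
      (n + n ∸ (b + 2) + (7 ∸ (5 ∸ b))) % n   ≡⟨ cong (_% n) (anchor-left z≤n b≤3) ⟩
      (n + n) % n                             ≡⟨ [m+n]%n≡m%n n n ⟩
      n % n                                   ≡⟨ n%n≡0 n ⟩
      0                                       ∎)
    where open ≡-Reasoning
  anchor-correct {suc a} {b} a<n b≤3 with suc a ≤? p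
  ... | yes a<p rewrite proj₁ (right-answers a<p) | proj₂ (right-answers a<p)
                      | dec-true (a + b <? suc a + b) ≤-refl = anchor-right a<n b≤3
  ... | no  a≮p rewrite proj₁ (left-answers (≤-pred (≰⇒> a≮p)) a<n) | proj₂ (left-answers (≤-pred (≰⇒> a≮p)) a<n)
                      | dec-false (n ∸ a + b <? n ∸ suc a + b) (≤⇒≯ (+-monoˡ-≤ b (∸-monoʳ-≤ n (n≤1+n a)))) =
    sym (begin
      (n + n ∸ (n ∸ suc a + b + 2) + (7 ∸ (5 ∸ b))) % n ≡⟨ cong (_% n) (anchor-left (m∸n≤m n (suc a)) b≤3) ⟩
      (n + (n ∸ (n ∸ suc a))) % n                       ≡⟨ cong (λ z → (n + z) % n) (m∸[m∸n]≡n (<⇒≤ a<n)) ⟩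
      (n + suc a) % n                                   ≡⟨ cong (_% n) (+-comm n (suc a)) ⟩
      (suc a + n) % n                                   ≡⟨ [m+n]%n≡m%n (suc a) n ⟩
      suc a % n                                         ≡⟨ m<n⇒m%n≡m a<n ⟩
      suc a                                             ∎)
    where open ≡-Reasoning

  probe₀ : Vec (V G) 2
  probe₀ = (0 mod n , # 0) ∷ (1 mod n , # 0) ∷ []

  rowHeight≤3 : (j : Fin 6) → cycleDist 6 (toℕ j) 0 ≤ 3
  rowHeight≤3 = decide₁ λ j → cycleDist 6 (toℕ j) 0 ≤? 3

  answers₀ : ∀ u j → map (dist G (u , j)) probe₀ ≡
             (cycleDist n (toℕ u) 0 + cycleDist 6 (toℕ j) 0 ∷ cycleDist n (toℕ u) 1 + cycleDist 6 (toℕ j) 0 ∷ [])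
  answers₀ u j rewrite dist-G u j (0 mod n) (# 0) | dist-G u j (1 mod n) (# 0)
                     | toℕ-fromℕ< (m%n<n 0 n) | toℕ-fromℕ< (m%n<n 1 n)
                     | m<n⇒m%n≡m {n = n} {m = 0} (≤-trans (s≤s z≤n) 6≤n)
                     | m<n⇒m%n≡m {n = n} {m = 1} (≤-trans (s≤s (s≤s z≤n)) 6≤n) = refl

  start-represented : ∀ w → Represents (anchor (map (dist G w) probe₀)) (start (proj₂ w)) w
  start-represented (u , j) = subst (λ a₀ → Represents (anchor a₀) (start j) (u , j)) (sym (answers₀ u j))
                                     (represents (anchor-correct (toℕ<n u) (rowHeight≤3 j)) refl)

  7∸L≡[6∸L]+1 : ∀ {L} → L ≤ 6 → 7 ∸ L ≡ 6 ∸ L + 1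
  7∸L≡[6∸L]+1 {L} L≤6 = trans (+-∸-assoc 1 L≤6) (+-comm 1 (6 ∸ L))

  column-forward : ∀ o {L} j → Interior (L , j) →
                   ∃ λ k → proj₂ (move k (L , j)) ≡ j × orient o (proj₁ (move k (L , j))) ≡ orient o L + 1
  column-forward up   {L}     j _                 = # 1 , refl , +-comm 1 L
  column-forward down {suc L} j (_ , s≤s L≤5)     = # 2 , refl , 7∸L≡[6∸L]+1 (≤-trans L≤5 (n≤1+n 5))

  column-backward : ∀ o {L} j → Interior (L , j) →
                    ∃ λ k → proj₂ (move k (L , j)) ≡ j × orient o (proj₁ (move k (L , j))) + 1 ≡ orient o L
  column-backward up   {suc L} j _            = # 2 , refl , +-comm L 1
  column-backward down {L}     j (_ , L≤6)    = # 1 , refl , sym (7∸L≡[6∸L]+1 L≤6)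

  row-neighbours : ∀ j j' → cycleAdj 6 j j' ≡ true → j' ≡ rotate 1 j ⊎ j' ≡ rotate 5 j
  row-neighbours = decide₂ λ j j' →
    (cycleAdj 6 j j' Bool.≟ true) →-dec ((j' Fin.≟ rotate 1 j) ⊎-dec (j' Fin.≟ rotate 5 j))

  lift-column : ∀ {f L j u u'} → Represents f (L , j) (u , j) → Interior (L , j) → cycleAdj n u u' ≡ true →
                ∃ λ k → Represents f (move k (L , j)) (u' , j)
  lift-column {o , e} {L} {j} {u} {u'} (represents u≡ refl) interior u~u'
    with cycleStep-% n (toℕ<n u) (toℕ<n u') (cycleAdjℕ⇒step n (toℕ u) (toℕ u') u~u')
  ... | inj₁ ahead with column-forward o j interior
  ...   | k , row≡ , col≡ = k , represents (begin
          toℕ u'                                      ≡⟨ ahead ⟩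
          (toℕ u + 1) % n                             ≡⟨ cong (λ z → (z + 1) % n) u≡ ⟩
          ((e + orient o L) % n + 1) % n              ≡⟨ [m%n+k]%n≡[m+k]%n n (e + orient o L) 1 ⟩
          (e + orient o L + 1) % n                    ≡⟨ cong (_% n) (trans (+-assoc e _ 1) (cong (e +_) (sym col≡))) ⟩
          (e + orient o (proj₁ (move k (L , j)))) % n ∎) (sym row≡)
    where open ≡-Reasoning
  lift-column {o , e} {L} {j} {u} {u'} (represents u≡ refl) interior u~u' | inj₂ behind
    with column-backward o j interior
  ...   | k , row≡ , col≡ = k , represents ([m+1]%n≡[k+1]%n⇒m≡k%n n (toℕ<n u') (begin
          (toℕ u' + 1) % n                                  ≡⟨ sym behind ⟩
          toℕ u                                             ≡⟨ u≡ ⟩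
          (e + orient o L) % n                              ≡⟨ cong (λ z → (e + z) % n) (sym col≡) ⟩
          (e + (orient o (proj₁ (move k (L , j))) + 1)) % n ≡⟨ cong (_% n) (sym (+-assoc e _ 1)) ⟩
          (e + orient o (proj₁ (move k (L , j))) + 1) % n   ∎)) (sym row≡)
    where open ≡-Reasoning

  lift-row : ∀ {f L j u j'} → Represents f (L , j) (u , j) → cycleAdj 6 j j' ≡ true →
             ∃ λ k → Represents f (move k (L , j)) (u , j')
  lift-row {j = j} {j' = j'} (represents u≡ refl) j~j' with row-neighbours j j' j~j'
  ... | inj₁ up-one   = # 3 , represents u≡ up-one
  ... | inj₂ down-one = # 4 , represents u≡ down-one

  lift-step : ∀ {f x w w'} → Represents f x w → Interior x → w' ≡ w ⊎ adj G w w' ≡ true →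
              ∃ λ k → Represents f (move k x) w'
  lift-step r _ (inj₁ refl) = # 0 , r
  lift-step {x = L , j} {u , .j} {u' , j'} r@(represents _ refl) interior (inj₂ w~w')
    with ∨-true⁻ (cycleAdj n u u' ∧ does (j Fin.≟ j')) w~w'
  ... | inj₁ column-move with ∧-true⁻ (cycleAdj n u u') column-move
  ...   | u~u' , j≡j' with refl ← does-true⁻ (j Fin.≟ j') j≡j' = lift-column r interior u~u'
  lift-step {x = L , j} {u , .j} {u' , j'} r@(represents _ refl) interior (inj₂ w~w') | inj₂ row-move
    with ∧-true⁻ (does (u Fin.≟ u')) row-move
  ... | u≡u' , j~j' with refl ← does-true⁻ (u Fin.≟ u') u≡u' = lift-row r j~j'

  strategy : Strategy G 2
  strategy []             = probe₀
  strategy (a₀ ∷ [])      = map (embed (anchor a₀)) probe₁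
  strategy (a₁ ∷ a₀ ∷ []) = map (embed (anchor a₀)) (probe₂ a₁)
  strategy _              = probe₀

  guess : List (Vec ℕ 2) → V G
  guess (a₂ ∷ a₁ ∷ a₀ ∷ []) = embed (anchor a₀) (locate a₁ a₂)
  guess _                   = embed (up , 0) (0 , # 0)

  guess-correct : ∀ w → IsWalk G w → guess (history G strategy w 3) ≡ w 2
  guess-correct w walk = begin
    embed f (locate a₁ a₂)                  ≡⟨ cong₂ (λ a a' → embed f (locate a a')) answers₁ answers₂ ⟩
    embed f (locate (localAnswers probe₁ x₁) (localAnswers (probe₂ (localAnswers probe₁ x₁)) x₂))
                                            ≡⟨ cong (embed f) (proj₂ (proj₂ locates)) ⟩
    embed f x₂                              ≡⟨ represents⇒embed r₂ ⟩
    w 2                                     ∎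
    where
      open ≡-Reasoning
      f  = anchor (map (dist G (w 0)) probe₀)
      j  = proj₂ (w 0)
      first-step  = lift-step (start-represented (w 0)) (start-interior j) (walk 0)
      x₁ = move (proj₁ first-step) (start j)
      r₁ = proj₂ first-step
      second-step = lift-step r₁ (step-interior j (proj₁ first-step)) (walk 1)
      x₂ = move (proj₁ second-step) x₁
      r₂ = proj₂ second-step
      locates = local-strategy-locates j (proj₁ first-step) (proj₁ second-step)
      a₁ = map (dist G (w 1)) (map (embed f) probe₁)
      a₂ = map (dist G (w 2)) (map (embed f) (probe₂ a₁))
      answers₁ : a₁ ≡ localAnswers probe₁ x₁
      answers₁ = answers-embed probe₁ r₁ (proj₁ locates)
      answers₂ : a₂ ≡ localAnswers (probe₂ (localAnswers probe₁ x₁)) x₂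
      answers₂ = trans (cong (λ a → map (dist G (w 2)) (map (embed f) (probe₂ a))) answers₁)
                       (answers-embed (probe₂ (localAnswers probe₁ x₁)) r₂ (proj₁ (proj₂ locates)))

  twoCopsWin : CopWins G 2
  twoCopsWin = strategy , λ w walk → 2 , λ w' walk' same →
    trans (sym (guess-correct w' walk')) (trans (cong guess same) (guess-correct w walk))

  oneCopLoses : ¬ CopWins G 1
  oneCopLoses = □C₆-oneCopLoses (cycleDistance n) (0 mod n)

proposition5p18 : (p : ℕ) → 3 ≤ p → LocalizationNumberIs (Cycle (2 * p) □ Cycle 6) 2
proposition5p18 p 3≤p = Torus.twoCopsWin p 3≤p , fewerCopsLose
  where
    fewerCopsLose : ∀ j → 1 ≤ j → j < 2 → ¬ CopWins (Cycle (2 * p) □ Cycle 6) j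
    fewerCopsLose 1             _ _                = Torus.oneCopLoses p 3≤p
    fewerCopsLose (suc (suc j)) _ (s≤s (s≤s ()))
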